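{- Let $d<e$. Let $\mathcal{B}=\{\mathbf{f}_1,\dots,\mathbf{f}_k\}\subseteq\mathbb{Z}[t]^m$ consist of parametric vectors all of degree $d$ with linearly independent pilot vectors, let $\mathcal{B}'\subseteq\mathbb{Z}[t]^m$ be a set of parametric vectors with $\mathcal{B}\perp^{asym}\mathcal{B}'$, and let $\mathbf{h}\in\mathbb{Z}[t]^m$ have degree $e$ and be asymptotically orthogonal to every element of $\mathcal{B}'$. Let $\alpha_1,\dots,\alpha_k\in\mathbb{Q}(t)$ be the coefficients with $\sum_{j=1}^k\alpha_j\mathbf{f}_j$ equal to the orthogonal projection (over $\mathbb{Q}(t)$) of $\mathbf{h}$ onto $\operatorname{Span}_{\mathbb{Q}(t)}(\mathcal{B})$, and set $\mathbf{h}'=\mathbf{h}-\sum_{j=1}^k\lfloor\alpha_j\rceil\mathbf{f}_j$ (a parametric vector with EQP coordinates). If $\deg(\mathbf{h}')=\deg(\mathbf{h})$, then $\mathbf{h}'$ is asymptotically orthogonal to every element of $\mathcal{B}'$.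
   Context: For a parametric vector, $\deg$ is the maximum degree of its coordinates and the pilot vector is the vector of coefficients of $t^{\deg}$ (for vectors with mild EQP coordinates, i.e. eventually given on each residue class mod some $N$ by polynomials with common degree and leading coefficient, these are eventually well defined). Two parametric vectors are asymptotically orthogonal if their pilot vectors are orthogonal; $S\perp^{asym}T$ means every element of $S$ is asymptotically orthogonal to every element of $T$. $\lfloor x\rceil$ is the nearest integer to $x$ ($=\lfloor x+1/2\rfloor$), applied pointwise in $t$. -}

module Defs where

open import Data.Nat using (ℕ; zero; suc; _<_; _≤_; _%_)
open import Data.Integer as ℤ using (ℤ; +_)
open import Data.Rational as ℚ using (ℚ; 0ℚ; ½; floor; _÷_)
open import Data.Rational.Properties using () renaming (_≟_ to _≟ℚ_)
open import Data.Fin using (Fin; zero; suc)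
open import Data.List using (List; []; _∷_)
open import Data.Product using (Σ; ∃; _×_; _,_)
open import Relation.Binary.PropositionalEquality using (_≡_; _≢_)
open import Relation.Nullary using (yes; no)

sumℤ : ∀ {n} → (Fin n → ℤ) → ℤ
sumℤ {zero}  f = + 0
sumℤ {suc n} f = f zero ℤ.+ sumℤ (λ i → f (suc i))

sumℚ : ∀ {n} → (Fin n → ℚ) → ℚ
sumℚ {zero}  f = 0ℚ
sumℚ {suc n} f = f zero ℚ.+ sumℚ (λ i → f (suc i))

toℚ : ℤ → ℚ
toℚ z = z ℚ./ 1

-- Polynomials: coefficient lists, index i = coefficient of t^i

ZPoly : Set
ZPoly = List ℤ

QPoly : Set
QPoly = List ℚ

coeff : ZPoly → ℕ → ℤ
coeff []       n       = + 0
coeff (a ∷ p)  zero    = a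
coeff (a ∷ p)  (suc n) = coeff p n

coeffQ : QPoly → ℕ → ℚ
coeffQ []       n       = 0ℚ
coeffQ (a ∷ p)  zero    = a
coeffQ (a ∷ p)  (suc n) = coeffQ p n

eval : ZPoly → ℕ → ℤ
eval []      t = + 0
eval (a ∷ p) t = a ℤ.+ (+ t) ℤ.* eval p t

evalQ : QPoly → ℕ → ℚ
evalQ []      t = 0ℚ
evalQ (a ∷ p) t = a ℚ.+ toℚ (+ t) ℚ.* evalQ p t

ZVec : ℕ → Set
ZVec m = Fin m → ZPoly

VDeg : ∀ {m} → ZVec m → ℕ → Set
VDeg {m} v D =
  ((c : Fin m) (n : ℕ) → D < n → coeff (v c) n ≡ + 0)
  × (∃ λ (c : Fin m) → coeff (v c) D ≢ + 0)

pilot : ∀ {m} → ZVec m → ℕ → Fin m → ℤ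
pilot v D c = coeff (v c) D

dotℤ : ∀ {m} → (Fin m → ℤ) → (Fin m → ℤ) → ℤ
dotℤ x y = sumℤ (λ i → x i ℤ.* y i)

AsymOrth : ∀ {m} → ZVec m → ZVec m → Set
AsymOrth u v = ∀ D D′ → VDeg u D → VDeg v D′ → dotℤ (pilot u D) (pilot v D′) ≡ + 0

-- Rational functions in ℚ(t), as num/den with den ∈ ℤ[t] nonzero

record RatFun : Set where
  constructor _/ᵣ_
  field
    num : ZPoly
    den : ZPoly

ValidRatFun : RatFun → Set
ValidRatFun r = ∃ λ n → coeff (RatFun.den r) n ≢ + 0

-- a / b in ℚ, with junk value 0 when b = 0
safeDiv : ℚ → ℚ → ℚ
safeDiv a b with b ≟ℚ 0ℚ
... | yes _  = 0ℚ
... | no b≢0 = _÷_ a b {{ℚ.≢-nonZero b≢0}}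

evalRat : RatFun → ℕ → ℚ
evalRat r t = safeDiv (toℚ (eval (RatFun.num r) t)) (toℚ (eval (RatFun.den r) t))

nearest : ℚ → ℤ
nearest x = floor (x ℚ.+ ½)

-- Orthogonal projection of h onto Span_{ℚ(t)}(f_1..f_k) has coefficients α:
-- ⟨f_i , h − Σ_j α_j f_j⟩ = 0 in ℚ(t) for every i.  An identity in ℚ(t)
-- is expressed by evaluating at every t ∈ ℕ where no denominator vanishes.

IsProjCoeffs : ∀ {m k} → (Fin k → ZVec m) → ZVec m → (Fin k → RatFun) → Set
IsProjCoeffs {m} {k} f h α =
  (∀ j → ValidRatFun (α j)) ×
  ((t : ℕ) → (∀ j → eval (RatFun.den (α j)) t ≢ + 0) → (i : Fin k) →
    sumℚ (λ c → toℚ (eval (f i c) t) ℚ.*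
                 (toℚ (eval (h c) t) ℚ.-
                  sumℚ (λ j → evalRat (α j) t ℚ.* toℚ (eval (f j c) t))))
    ≡ 0ℚ)

hPrime : ∀ {m k} → (Fin k → ZVec m) → ZVec m → (Fin k → RatFun) → ℕ → Fin m → ℤ
hPrime f h α t c =
  eval (h c) t ℤ.- sumℤ (λ j → nearest (evalRat (α j) t) ℤ.* eval (f j c) t)

-- Degree and pilot vector of a parametric vector with (mild) EQP coordinates:
-- g has degree D and pilot vector p iff p ≠ 0 and, for some period N = suc n
-- and all sufficiently large t, g(t) = P_{t mod N}(t) where every piece
-- P_r ∈ ℚ[t]^m has all coordinates of degree ≤ D with t^D-coefficients p.

EQPDegPilot : ∀ {m} → (ℕ → Fin m → ℤ) → ℕ → (Fin m → ℚ) → Set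
EQPDegPilot {m} g D p =
  (∃ λ (c : Fin m) → p c ≢ 0ℚ) ×
  (Σ ℕ λ n → Σ ℕ λ T → Σ (ℕ → Fin m → QPoly) λ P →
     ((t : ℕ) → T ≤ t → (c : Fin m) → toℚ (g t c) ≡ evalQ (P (t % suc n) c) t)
     × ((r : ℕ) → r < suc n → (c : Fin m) →
          ((e : ℕ) → D < e → coeffQ (P r c) e ≡ 0ℚ) × (coeffQ (P r c) D ≡ p c)))

LinIndep : ∀ {m k} → (Fin k → Fin m → ℤ) → Set
LinIndep {m} {k} v =
  (λc : Fin k → ℤ) → (∀ (c : Fin m) → sumℤ (λ j → λc j ℤ.* v j c) ≡ + 0) → ∀ j → λc j ≡ + 0

-- Write h′ = h − Σ ν_j f_j with ν_j(t) = ⌊α_j(t)⌉ and let w be the pilot vector of some b ∈ B′.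
-- As h and h′ both have degree e, the combination Σ ν_j f_j = h − h′ is O(t^e); pairing it with
-- a rational dual family of the linearly independent pilots of the f_j gives t^d Σ |ν_j| = O(t^e).
-- Asymptotic orthogonality makes ⟨h, w⟩ = O(t^(e−1)) and ⟨f_j, w⟩ = O(t^(d−1)), hence
-- ⟨h′, w⟩ = ⟨h, w⟩ − Σ ν_j ⟨f_j, w⟩ = O(t^(e−1)). Along a residue class of the period of h′ we
-- also have ⟨h′, w⟩ = t^e ⟨p, w⟩ + O(t^(e−1)), so t ⟨p, w⟩ stays bounded as t → ∞ and ⟨p, w⟩ = 0.

module Submission where

open import Defs
open import Data.Nat as ℕ using (ℕ; zero; suc; _<_)
open import Data.Nat.DivMod using (_%_; m*n%n≡0)
import Data.Nat.Properties as ℕP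
open import Data.Integer as ℤ using (ℤ; +_)
import Data.Integer.Properties as ℤP
import Data.Integer.Solver as ℤSolver
open import Data.Rational as ℚ using (ℚ; 0ℚ; 1ℚ; _+_; _*_; -_; _-_; ∣_∣; _≤_; 1/_)
import Data.Rational.Properties as ℚP
open import Data.Rational.Solver using (module +-*-Solver)
import Data.Rational.Unnormalised as ℚᵘ
import Data.Rational.Unnormalised.Properties as ℚᵘP
open import Algebra.Definitions.RawSemiring ℚ.+-*-rawSemiring using (_^_)
open import Data.Fin using (Fin; zero; suc)
import Data.Fin.Properties as FinP
open import Data.List using ([]; _∷_)
open import Data.Product using (∃; _×_; _,_; proj₁; proj₂; uncurry)
open import Data.Sum using (inj₁; inj₂)
open import Data.Empty using (⊥-elim)
open import Relation.Nullary using (¬_; yes; no)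
open import Relation.Binary.PropositionalEquality

toℚᵘ-toℚ : ∀ a → ℚ.toℚᵘ (toℚ a) ℚᵘ.≃ ℚᵘ.mkℚᵘ a 0
toℚᵘ-toℚ a = ℚP.toℚᵘ-fromℚᵘ (ℚᵘ.mkℚᵘ a 0)

toℚ-+ : ∀ a b → toℚ (a ℤ.+ b) ≡ toℚ a + toℚ b
toℚ-+ a b = ℚP.toℚᵘ-injective (ℚᵘP.≃-trans (toℚᵘ-toℚ (a ℤ.+ b)) (ℚᵘP.≃-sym
  (ℚᵘP.≃-trans (ℚP.toℚᵘ-homo-+ (toℚ a) (toℚ b))
  (ℚᵘP.≃-trans (ℚᵘP.+-cong (toℚᵘ-toℚ a) (toℚᵘ-toℚ b)) (ℚᵘ.*≡* (cong (ℤ._* + 1) over1))))))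
  where
  over1 : a ℤ.* + 1 ℤ.+ b ℤ.* + 1 ≡ a ℤ.+ b
  over1 = cong₂ ℤ._+_ (ℤP.*-identityʳ a) (ℤP.*-identityʳ b)

toℚ-* : ∀ a b → toℚ (a ℤ.* b) ≡ toℚ a * toℚ b
toℚ-* a b = ℚP.toℚᵘ-injective (ℚᵘP.≃-trans (toℚᵘ-toℚ (a ℤ.* b)) (ℚᵘP.≃-sym
  (ℚᵘP.≃-trans (ℚP.toℚᵘ-homo-* (toℚ a) (toℚ b)) (ℚᵘP.*-cong (toℚᵘ-toℚ a) (toℚᵘ-toℚ b)))))

toℚ-neg : ∀ a → toℚ (ℤ.- a) ≡ - toℚ a
toℚ-neg a = ℚP.toℚᵘ-injective (ℚᵘP.≃-trans (toℚᵘ-toℚ (ℤ.- a)) (ℚᵘP.≃-sym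
  (ℚᵘP.≃-trans (ℚP.toℚᵘ-homo‿- (toℚ a)) (ℚᵘP.-‿cong (toℚᵘ-toℚ a)))))

toℚ-injective : ∀ {a b} → toℚ a ≡ toℚ b → a ≡ b
toℚ-injective {a} {b} eq
  with ℚᵘP.≃-trans (ℚᵘP.≃-sym (toℚᵘ-toℚ a)) (ℚᵘP.≃-trans (ℚP.toℚᵘ-cong eq) (toℚᵘ-toℚ b))
... | ℚᵘ.*≡* a*1≡b*1 = trans (sym (ℤP.*-identityʳ a)) (trans a*1≡b*1 (ℤP.*-identityʳ b))

toℚ-mono-≤ : ∀ {a b} → a ℤ.≤ b → toℚ a ≤ toℚ b
toℚ-mono-≤ {a} {b} a≤b = ℚP.toℚᵘ-cancel-≤
  (ℚᵘP.≤-respˡ-≃ (ℚᵘP.≃-sym (toℚᵘ-toℚ a)) (ℚᵘP.≤-respʳ-≃ (ℚᵘP.≃-sym (toℚᵘ-toℚ b))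
    (ℚᵘ.*≤* (subst₂ ℤ._≤_ (sym (ℤP.*-identityʳ a)) (sym (ℤP.*-identityʳ b)) a≤b))))

fromℕ : ℕ → ℚ
fromℕ t = toℚ (+ t)

fromℕ-mono-≤ : ∀ {s t} → s ℕ.≤ t → fromℕ s ≤ fromℕ t
fromℕ-mono-≤ s≤t = toℚ-mono-≤ (ℤ.+≤+ s≤t)

fromℕ-nonNeg : ∀ t → 0ℚ ≤ fromℕ t
fromℕ-nonNeg t = fromℕ-mono-≤ {0} {t} ℕ.z≤n

archimedean : ∀ q → ∃ λ n → q ≤ fromℕ n
archimedean (ℚ.mkℚ (+ n) _ _) = n , ℚP.toℚᵘ-cancel-≤ (ℚᵘP.≤-respʳ-≃ (ℚᵘP.≃-sym (toℚᵘ-toℚ (+ n)))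
  (ℚᵘ.*≤* (ℤP.*-monoˡ-≤-nonNeg (+ n) (ℤ.+≤+ (ℕ.s≤s ℕ.z≤n)))))
archimedean (ℚ.mkℚ ℤ.-[1+ n ] _ _) = 0 , ℚP.toℚᵘ-cancel-≤ (ℚᵘP.≤-respʳ-≃ (ℚᵘP.≃-sym (toℚᵘ-toℚ (+ 0))) (ℚᵘ.*≤* ℤ.-≤+))

0<1 : 0ℚ ℚ.< 1ℚ
0<1 = ℚ.*<* (ℤ.+<+ (ℕ.s≤s ℕ.z≤n))

0≤1 : 0ℚ ≤ 1ℚ
0≤1 = fromℕ-mono-≤ {0} {1} ℕ.z≤n

*-monoˡ-≤-0≤ : ∀ {r p q} → 0ℚ ≤ r → p ≤ q → r * p ≤ r * q
*-monoˡ-≤-0≤ {r} 0≤r = ℚP.*-monoˡ-≤-nonNeg r {{ℚ.nonNegative 0≤r}}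

*-monoʳ-≤-0≤ : ∀ {r p q} → 0ℚ ≤ r → p ≤ q → p * r ≤ q * r
*-monoʳ-≤-0≤ {r} 0≤r = ℚP.*-monoʳ-≤-nonNeg r {{ℚ.nonNegative 0≤r}}

0≤-* : ∀ {p q} → 0ℚ ≤ p → 0ℚ ≤ q → 0ℚ ≤ p * q
0≤-* {p} 0≤p 0≤q = ℚP.≤-trans (ℚP.≤-reflexive (sym (ℚP.*-zeroʳ p))) (*-monoˡ-≤-0≤ 0≤p 0≤q)

^-nonNeg : ∀ {x} n → 0ℚ ≤ x → 0ℚ ≤ x ^ n
^-nonNeg zero    0≤x = 0≤1
^-nonNeg (suc n) 0≤x = 0≤-* 0≤x (^-nonNeg n 0≤x)

1≤^ : ∀ {x} n → 1ℚ ≤ x → 1ℚ ≤ x ^ n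
1≤^ zero    1≤x = ℚP.≤-refl
1≤^ {x} (suc n) 1≤x = begin
  1ℚ         ≤⟨ 1≤x ⟩
  x          ≡⟨ sym (ℚP.*-identityʳ x) ⟩
  x * 1ℚ     ≤⟨ *-monoˡ-≤-0≤ (ℚP.≤-trans 0≤1 1≤x) (1≤^ n 1≤x) ⟩
  x * x ^ n  ∎
  where open ℚP.≤-Reasoning

1≤⇒positive : ∀ {x} → 1ℚ ≤ x → ℚ.Positive x
1≤⇒positive 1≤x = ℚ.positive (ℚP.<-≤-trans 0<1 1≤x)

∣*∣-0≤ : ∀ {s} → 0ℚ ≤ s → ∀ x → ∣ s * x ∣ ≡ s * ∣ x ∣
∣*∣-0≤ {s} 0≤s x = trans (ℚP.∣p*q∣≡∣p∣*∣q∣ s x) (cong (_* ∣ x ∣) (ℚP.0≤p⇒∣p∣≡p 0≤s))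

+-cancelˡ-≤ : ∀ a {b c} → a + b ≤ a + c → b ≤ c
+-cancelˡ-≤ a {b} {c} a+b≤a+c = begin
  b             ≡⟨ unshift b ⟩
  - a + (a + b) ≤⟨ ℚP.+-monoʳ-≤ (- a) a+b≤a+c ⟩
  - a + (a + c) ≡⟨ sym (unshift c) ⟩
  c             ∎
  where
  open ℚP.≤-Reasoning
  open +-*-Solver
  unshift : ∀ x → x ≡ - a + (a + x)
  unshift = solve 2 (λ a x → x := :- a :+ (a :+ x)) refl a

≤-absorb : ∀ {a b c} → a ≤ b + c → c + c ≤ a → a ≤ b + b
≤-absorb {a} {b} {c} a≤b+c c+c≤a = ℚP.≤-trans a≤b+c (ℚP.+-monoʳ-≤ b c≤b)
  where
  c≤b : c ≤ b
  c≤b = +-cancelˡ-≤ c (ℚP.≤-trans c+c≤a (ℚP.≤-trans a≤b+c (ℚP.≤-reflexive (ℚP.+-comm b c))))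

archimedean-zero : ∀ {x K} → (∀ M → ∃ λ t → M ℕ.≤ t × fromℕ t * ∣ x ∣ ≤ K) → x ≡ 0ℚ
archimedean-zero {x} {K} t∣x∣≤K with x ℚP.≟ 0ℚ
... | yes x≡0 = x≡0
... | no  x≢0 = ⊥-elim (ℚP.<-irrefl refl (ℚP.<-≤-trans 0<1 (+-cancelˡ-≤ K K+1≤K+0)))
  where
  instance
    ∣x∣-nonZero : ℚ.NonZero ∣ x ∣
    ∣x∣-nonZero = ℚ.≢-nonZero (λ ∣x∣≡0 → x≢0 (ℚP.∣p∣≡0⇒p≡0 x ∣x∣≡0))
  q : ℚ
  q = (K + 1ℚ) * 1/ ∣ x ∣
  M t : ℕ
  M = proj₁ (archimedean q)
  t = proj₁ (t∣x∣≤K M)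
  K+1≤K+0 : K + 1ℚ ≤ K + 0ℚ
  K+1≤K+0 = begin
    K + 1ℚ
      ≡⟨ sym (trans (ℚP.*-assoc (K + 1ℚ) (1/ ∣ x ∣) ∣ x ∣) (trans (cong (_*_ (K + 1ℚ)) (ℚP.*-inverseˡ ∣ x ∣)) (ℚP.*-identityʳ _))) ⟩
    q * ∣ x ∣      ≤⟨ *-monoʳ-≤-0≤ (ℚP.0≤∣p∣ x) (ℚP.≤-trans (proj₂ (archimedean q)) (fromℕ-mono-≤ (proj₁ (proj₂ (t∣x∣≤K M))))) ⟩
    fromℕ t * ∣ x ∣ ≤⟨ proj₂ (proj₂ (t∣x∣≤K M)) ⟩
    K              ≡⟨ sym (ℚP.+-identityʳ K) ⟩
    K + 0ℚ         ∎
    where open ℚP.≤-Reasoning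

sumℚ-cong : ∀ {n} {f g : Fin n → ℚ} → (∀ i → f i ≡ g i) → sumℚ f ≡ sumℚ g
sumℚ-cong {zero}  f≗g = refl
sumℚ-cong {suc n} f≗g = cong₂ _+_ (f≗g zero) (sumℚ-cong (λ i → f≗g (suc i)))

sumℚ-zero : ∀ n → sumℚ {n} (λ _ → 0ℚ) ≡ 0ℚ
sumℚ-zero zero    = refl
sumℚ-zero (suc n) = cong (_+_ 0ℚ) (sumℚ-zero n)

sumℚ-distrib-+ : ∀ {n} (f g : Fin n → ℚ) → sumℚ (λ i → f i + g i) ≡ sumℚ f + sumℚ g
sumℚ-distrib-+ {zero}  f g = refl
sumℚ-distrib-+ {suc n} f g =
  trans (cong (_+_ (f zero + g zero)) (sumℚ-distrib-+ (λ i → f (suc i)) (λ i → g (suc i))))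
        (interchange (f zero) (g zero) _ _)
  where
  open +-*-Solver
  interchange : ∀ a b c d → a + b + (c + d) ≡ a + c + (b + d)
  interchange = solve 4 (λ a b c d → a :+ b :+ (c :+ d) := a :+ c :+ (b :+ d)) refl

sumℚ-*ˡ : ∀ {n} a (f : Fin n → ℚ) → sumℚ (λ i → a * f i) ≡ a * sumℚ f
sumℚ-*ˡ {zero}  a f = sym (ℚP.*-zeroʳ a)
sumℚ-*ˡ {suc n} a f = trans (cong (_+_ (a * f zero)) (sumℚ-*ˡ a (λ i → f (suc i))))
                            (sym (ℚP.*-distribˡ-+ a (f zero) _))

sumℚ-*ʳ : ∀ {n} a (f : Fin n → ℚ) → sumℚ (λ i → f i * a) ≡ sumℚ f * a
sumℚ-*ʳ a f = trans (sumℚ-cong (λ i → ℚP.*-comm (f i) a)) (trans (sumℚ-*ˡ a f) (ℚP.*-comm a _))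

sumℚ-neg : ∀ {n} (f : Fin n → ℚ) → sumℚ (λ i → - f i) ≡ - sumℚ f
sumℚ-neg {zero}  f = refl
sumℚ-neg {suc n} f = trans (cong (_+_ (- f zero)) (sumℚ-neg (λ i → f (suc i))))
                           (sym (ℚP.neg-distrib-+ (f zero) _))

sumℚ-distrib-- : ∀ {n} (f g : Fin n → ℚ) → sumℚ (λ i → f i - g i) ≡ sumℚ f - sumℚ g
sumℚ-distrib-- f g = trans (sumℚ-distrib-+ f (λ i → - g i)) (cong (_+_ (sumℚ f)) (sumℚ-neg g))

sumℚ-comm : ∀ {n m} (a : Fin n → Fin m → ℚ) →
            sumℚ (λ i → sumℚ (λ j → a i j)) ≡ sumℚ (λ j → sumℚ (λ i → a i j))
sumℚ-comm {zero}  {m} a = sym (sumℚ-zero m)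
sumℚ-comm {suc n} {m} a = trans (cong (_+_ (sumℚ (a zero))) (sumℚ-comm (λ i → a (suc i))))
                                (sym (sumℚ-distrib-+ (a zero) (λ j → sumℚ (λ i → a (suc i) j))))

sumℚ-const : ∀ n a → sumℚ {n} (λ _ → a) ≡ fromℕ n * a
sumℚ-const zero    a = sym (ℚP.*-zeroˡ a)
sumℚ-const (suc n) a = begin-equality
  a + sumℚ {n} (λ _ → a)  ≡⟨ cong (_+_ a) (sumℚ-const n a) ⟩
  a + fromℕ n * a         ≡⟨ cong (_+ fromℕ n * a) (sym (ℚP.*-identityˡ a)) ⟩
  1ℚ * a + fromℕ n * a    ≡⟨ sym (ℚP.*-distribʳ-+ a 1ℚ (fromℕ n)) ⟩
  (1ℚ + fromℕ n) * a      ≡⟨ cong (_* a) (sym (toℚ-+ (+ 1) (+ n))) ⟩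
  fromℕ (suc n) * a       ∎
  where open ℚP.≤-Reasoning

sumℚ-mono-≤ : ∀ {n} {f g : Fin n → ℚ} → (∀ i → f i ≤ g i) → sumℚ f ≤ sumℚ g
sumℚ-mono-≤ {zero}  f≤g = ℚP.≤-refl
sumℚ-mono-≤ {suc n} f≤g = ℚP.+-mono-≤ (f≤g zero) (sumℚ-mono-≤ (λ i → f≤g (suc i)))

sumℚ-nonNeg : ∀ {n} {f : Fin n → ℚ} → (∀ i → 0ℚ ≤ f i) → 0ℚ ≤ sumℚ f
sumℚ-nonNeg {n} 0≤f = ℚP.≤-trans (ℚP.≤-reflexive (sym (sumℚ-zero n))) (sumℚ-mono-≤ 0≤f)

≤-sumℚ : ∀ {n} {f : Fin n → ℚ} → (∀ i → 0ℚ ≤ f i) → ∀ i → f i ≤ sumℚ f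
≤-sumℚ {suc n} {f} 0≤f zero = begin
  f zero           ≡⟨ sym (ℚP.+-identityʳ (f zero)) ⟩
  f zero + 0ℚ      ≤⟨ ℚP.+-monoʳ-≤ (f zero) (sumℚ-nonNeg (λ i → 0≤f (suc i))) ⟩
  sumℚ f           ∎
  where open ℚP.≤-Reasoning
≤-sumℚ {suc n} {f} 0≤f (suc i) = begin
  f (suc i)                       ≤⟨ ≤-sumℚ (λ i → 0≤f (suc i)) i ⟩
  sumℚ (λ i → f (suc i))          ≡⟨ sym (ℚP.+-identityˡ _) ⟩
  0ℚ + sumℚ (λ i → f (suc i))     ≤⟨ ℚP.+-monoˡ-≤ _ (0≤f zero) ⟩
  sumℚ f                          ∎
  where open ℚP.≤-Reasoning

∣sumℚ∣≤sumℚ∣∣ : ∀ {n} (f : Fin n → ℚ) → ∣ sumℚ f ∣ ≤ sumℚ (λ i → ∣ f i ∣)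
∣sumℚ∣≤sumℚ∣∣ {zero}  f = ℚP.≤-refl
∣sumℚ∣≤sumℚ∣∣ {suc n} f = ℚP.≤-trans (ℚP.∣p+q∣≤∣p∣+∣q∣ (f zero) _)
                                    (ℚP.+-monoʳ-≤ ∣ f zero ∣ (∣sumℚ∣≤sumℚ∣∣ (λ i → f (suc i))))

toℚ-sumℤ : ∀ {n} (f : Fin n → ℤ) → toℚ (sumℤ f) ≡ sumℚ (λ i → toℚ (f i))
toℚ-sumℤ {zero}  f = refl
toℚ-sumℤ {suc n} f = trans (toℚ-+ (f zero) _) (cong (_+_ (toℚ (f zero))) (toℚ-sumℤ (λ i → f (suc i))))

toℚ-dotℤ : ∀ {m} (x y : Fin m → ℤ) → toℚ (dotℤ x y) ≡ sumℚ (λ c → toℚ (x c) * toℚ (y c))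
toℚ-dotℤ x y = trans (toℚ-sumℤ (λ c → x c ℤ.* y c)) (sumℚ-cong (λ c → toℚ-* (x c) (y c)))

sumℤ-cong : ∀ {n} {f g : Fin n → ℤ} → (∀ i → f i ≡ g i) → sumℤ f ≡ sumℤ g
sumℤ-cong {zero}  f≗g = refl
sumℤ-cong {suc n} f≗g = cong₂ ℤ._+_ (f≗g zero) (sumℤ-cong (λ i → f≗g (suc i)))

sumℤ-distrib-+ : ∀ {n} (f g : Fin n → ℤ) → sumℤ (λ i → f i ℤ.+ g i) ≡ sumℤ f ℤ.+ sumℤ g
sumℤ-distrib-+ {zero}  f g = refl
sumℤ-distrib-+ {suc n} f g =
  trans (cong (ℤ._+_ (f zero ℤ.+ g zero)) (sumℤ-distrib-+ (λ i → f (suc i)) (λ i → g (suc i))))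
        (interchange (f zero) (g zero) _ _)
  where
  open ℤSolver.+-*-Solver
  interchange : ∀ a b c d → a ℤ.+ b ℤ.+ (c ℤ.+ d) ≡ a ℤ.+ c ℤ.+ (b ℤ.+ d)
  interchange = solve 4 (λ a b c d → a :+ b :+ (c :+ d) := a :+ c :+ (b :+ d)) refl

sumℤ-*ʳ : ∀ {n} b (f : Fin n → ℤ) → sumℤ (λ i → f i ℤ.* b) ≡ sumℤ f ℤ.* b
sumℤ-*ʳ {zero}  b f = sym (ℤP.*-zeroˡ b)
sumℤ-*ʳ {suc n} b f = trans (cong (ℤ._+_ (f zero ℤ.* b)) (sumℤ-*ʳ b (λ i → f (suc i))))
                            (sym (ℤP.*-distribʳ-+ b (f zero) _))

sumℤ-neg : ∀ {n} (f : Fin n → ℤ) → sumℤ (λ i → ℤ.- f i) ≡ ℤ.- sumℤ f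
sumℤ-neg {zero}  f = refl
sumℤ-neg {suc n} f = trans (cong (ℤ._+_ (ℤ.- f zero)) (sumℤ-neg (λ i → f (suc i))))
                           (sym (ℤP.neg-distrib-+ (f zero) _))

sumℤ-zero : ∀ n → sumℤ {n} (λ _ → + 0) ≡ + 0
sumℤ-zero zero    = refl
sumℤ-zero (suc n) = cong (ℤ._+_ (+ 0)) (sumℤ-zero n)

δ : ∀ {n} → Fin n → Fin n → ℚ
δ zero    zero    = 1ℚ
δ zero    (suc j) = 0ℚ
δ (suc i) zero    = 0ℚ
δ (suc i) (suc j) = δ i j

δ-sym : ∀ {n} (i j : Fin n) → δ i j ≡ δ j i
δ-sym zero    zero    = refl
δ-sym zero    (suc j) = refl
δ-sym (suc i) zero    = refl
δ-sym (suc i) (suc j) = δ-sym i j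

sumℚ-δˡ : ∀ {n} (i : Fin n) (x : Fin n → ℚ) → sumℚ (λ j → δ i j * x j) ≡ x i
sumℚ-δˡ {suc n} zero x = begin-equality
  1ℚ * x zero + sumℚ (λ j → 0ℚ * x (suc j))  ≡⟨ cong₂ _+_ (ℚP.*-identityˡ (x zero)) (sumℚ-cong (λ j → ℚP.*-zeroˡ (x (suc j)))) ⟩
  x zero + sumℚ {n} (λ _ → 0ℚ)               ≡⟨ cong (_+_ (x zero)) (sumℚ-zero n) ⟩
  x zero + 0ℚ                                ≡⟨ ℚP.+-identityʳ (x zero) ⟩
  x zero                                     ∎
  where open ℚP.≤-Reasoning
sumℚ-δˡ {suc n} (suc i) x =
  trans (cong₂ _+_ (ℚP.*-zeroˡ (x zero)) (sumℚ-δˡ i (λ j → x (suc j)))) (ℚP.+-identityˡ _)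

sumℚ-δʳ : ∀ {n} (i : Fin n) (x : Fin n → ℚ) → sumℚ (λ j → x j * δ j i) ≡ x i
sumℚ-δʳ i x = trans (sumℚ-cong (λ j → trans (ℚP.*-comm (x j) _) (cong (_* x j) (δ-sym j i)))) (sumℚ-δˡ i x)

DualFamily : ∀ {m k} → (Fin k → Fin m → ℚ) → (Fin k → Fin m → ℚ) → Set
DualFamily V u = ∀ i j → sumℚ (λ c → u i c * V j c) ≡ δ i j

linIndep⇒nonzero-coordinate : ∀ {m k} (v : Fin (suc k) → Fin m → ℤ) → LinIndep v →
                               ∃ λ c → v zero c ≢ + 0
linIndep⇒nonzero-coordinate {m} {k} v indep =
  FinP.¬∀⟶∃¬ m (λ c → v zero c ≡ + 0) (λ c → v zero c ℤP.≟ + 0) v₀≢0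
  where
  unit : Fin (suc k) → ℤ
  unit zero    = + 1
  unit (suc _) = + 0
  v₀≢0 : ¬ (∀ c → v zero c ≡ + 0)
  v₀≢0 v₀≡0 with indep unit (λ c → cong₂ ℤ._+_ (trans (ℤP.*-identityˡ (v zero c)) (v₀≡0 c))
                                                 (trans (sumℤ-cong (λ j → ℤP.*-zeroˡ (v (suc j) c))) (sumℤ-zero k))) zero
  ... | ()

-- eliminated j is v (suc j) with its c-th coordinate cleared by v zero; a dual family of the
-- eliminated vectors lifts to one of v.
module Elimination {m k} (v : Fin (suc k) → Fin m → ℤ) (c : Fin m) (a≢0 : v zero c ≢ + 0) where

  a : ℤ
  a = v zero c

  eliminated : Fin k → Fin m → ℤ
  eliminated j c′ = a ℤ.* v (suc j) c′ ℤ.- v (suc j) c ℤ.* v zero c′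

  lift : (Fin k → ℤ) → Fin (suc k) → ℤ
  lift λ′ zero    = ℤ.- sumℤ (λ j → λ′ j ℤ.* v (suc j) c)
  lift λ′ (suc j) = a ℤ.* λ′ j

  combination-lift : ∀ λ′ c′ → sumℤ (λ j → lift λ′ j ℤ.* v j c′) ≡ sumℤ (λ j → λ′ j ℤ.* eliminated j c′)
  combination-lift λ′ c′ = begin
    lift λ′ zero ℤ.* v zero c′ ℤ.+ sumℤ (λ j → (a ℤ.* λ′ j) ℤ.* v (suc j) c′)
      ≡⟨ cong (λ z → z ℤ.* v zero c′ ℤ.+ rest) (sym (sumℤ-neg (λ j → λ′ j ℤ.* v (suc j) c))) ⟩
    sumℤ (λ j → ℤ.- (λ′ j ℤ.* v (suc j) c)) ℤ.* v zero c′ ℤ.+ sumℤ (λ j → (a ℤ.* λ′ j) ℤ.* v (suc j) c′)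
      ≡⟨ cong (ℤ._+ rest) (sym (sumℤ-*ʳ (v zero c′) (λ j → ℤ.- (λ′ j ℤ.* v (suc j) c)))) ⟩
    sumℤ (λ j → ℤ.- (λ′ j ℤ.* v (suc j) c) ℤ.* v zero c′) ℤ.+ sumℤ (λ j → (a ℤ.* λ′ j) ℤ.* v (suc j) c′)
      ≡⟨ sym (sumℤ-distrib-+ (λ j → ℤ.- (λ′ j ℤ.* v (suc j) c) ℤ.* v zero c′) (λ j → (a ℤ.* λ′ j) ℤ.* v (suc j) c′)) ⟩
    sumℤ (λ j → ℤ.- (λ′ j ℤ.* v (suc j) c) ℤ.* v zero c′ ℤ.+ (a ℤ.* λ′ j) ℤ.* v (suc j) c′)
      ≡⟨ sumℤ-cong (λ j → regroup a (λ′ j) (v (suc j) c′) (v (suc j) c) (v zero c′)) ⟩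
    sumℤ (λ j → λ′ j ℤ.* eliminated j c′) ∎
    where
    rest : ℤ
    rest = sumℤ (λ j → (a ℤ.* λ′ j) ℤ.* v (suc j) c′)
    open ≡-Reasoning
    open ℤSolver.+-*-Solver
    regroup : ∀ a l x y z → ℤ.- (l ℤ.* y) ℤ.* z ℤ.+ (a ℤ.* l) ℤ.* x ≡ l ℤ.* (a ℤ.* x ℤ.- y ℤ.* z)
    regroup = solve 5 (λ a l x y z → (:- (l :* y)) :* z :+ (a :* l) :* x := l :* (a :* x :- y :* z)) refl

  linIndep-eliminated : LinIndep v → LinIndep eliminated
  linIndep-eliminated indep λ′ λ′·v′≡0 j
    with ℤP.i*j≡0⇒i≡0∨j≡0 a (indep (lift λ′) (λ c′ → trans (combination-lift λ′ c′) (λ′·v′≡0 c′)) (suc j))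
  ... | inj₁ a≡0  = ⊥-elim (a≢0 a≡0)
  ... | inj₂ λ′≡0 = λ′≡0

  A : ℚ
  A = toℚ a

  instance
    A-nonZero : ℚ.NonZero A
    A-nonZero = ℚ.≢-nonZero (λ A≡0 → a≢0 (toℚ-injective A≡0))

  V : Fin (suc k) → Fin m → ℚ
  V j c′ = toℚ (v j c′)

  toℚ-eliminated : ∀ j c′ → toℚ (eliminated j c′) ≡ A * V (suc j) c′ - V (suc j) c * V zero c′
  toℚ-eliminated j c′ = trans (toℚ-+ (a ℤ.* v (suc j) c′) _) (cong₂ _+_ (toℚ-* a (v (suc j) c′))
    (trans (toℚ-neg (v (suc j) c ℤ.* v zero c′)) (cong -_ (toℚ-* (v (suc j) c) (v zero c′)))))

  module Lift (u′ : Fin k → Fin m → ℚ) (u′-dual : DualFamily (λ j c′ → toℚ (eliminated j c′)) u′) where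

    x : Fin k → ℚ
    x i = - sumℚ (λ c′ → u′ i c′ * V zero c′)

    tailDual : Fin k → Fin m → ℚ
    tailDual i c′ = A * u′ i c′ + δ c c′ * x i

    liftDual : Fin (suc k) → Fin m → ℚ
    liftDual zero    c′ = 1/ A * (δ c c′ - sumℚ (λ i → V (suc i) c * tailDual i c′))
    liftDual (suc i) c′ = tailDual i c′

    open +-*-Solver

    tailDual-· : ∀ i j → sumℚ (λ c′ → tailDual i c′ * V j c′) ≡ A * sumℚ (λ c′ → u′ i c′ * V j c′) + x i * V j c
    tailDual-· i j = begin-equality
      sumℚ (λ c′ → tailDual i c′ * V j c′)
        ≡⟨ sumℚ-cong (λ c′ → expand A (u′ i c′) (δ c c′) (x i) (V j c′)) ⟩
      sumℚ (λ c′ → A * (u′ i c′ * V j c′) + x i * (δ c c′ * V j c′))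
        ≡⟨ sumℚ-distrib-+ (λ c′ → A * (u′ i c′ * V j c′)) (λ c′ → x i * (δ c c′ * V j c′)) ⟩
      sumℚ (λ c′ → A * (u′ i c′ * V j c′)) + sumℚ (λ c′ → x i * (δ c c′ * V j c′))
        ≡⟨ cong₂ _+_ (sumℚ-*ˡ A (λ c′ → u′ i c′ * V j c′)) (sumℚ-*ˡ (x i) (λ c′ → δ c c′ * V j c′)) ⟩
      A * sumℚ (λ c′ → u′ i c′ * V j c′) + x i * sumℚ (λ c′ → δ c c′ * V j c′)
        ≡⟨ cong (λ z → A * sumℚ (λ c′ → u′ i c′ * V j c′) + x i * z) (sumℚ-δˡ c (V j)) ⟩
      A * sumℚ (λ c′ → u′ i c′ * V j c′) + x i * V j c ∎
      where
      open ℚP.≤-Reasoning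
      expand : ∀ A u d x V → (A * u + d * x) * V ≡ A * (u * V) + x * (d * V)
      expand = solve 5 (λ A u d x V → (A :* u :+ d :* x) :* V := A :* (u :* V) :+ x :* (d :* V)) refl

    u′-·-eliminated : ∀ i j → sumℚ (λ c′ → u′ i c′ * toℚ (eliminated j c′)) ≡ A * sumℚ (λ c′ → u′ i c′ * V (suc j) c′) + x i * V (suc j) c
    u′-·-eliminated i j = begin-equality
      sumℚ (λ c′ → u′ i c′ * toℚ (eliminated j c′))
        ≡⟨ sumℚ-cong (λ c′ → trans (cong (_*_ (u′ i c′)) (toℚ-eliminated j c′))
                                    (expand (u′ i c′) A (V (suc j) c′) (V (suc j) c) (V zero c′))) ⟩
      sumℚ (λ c′ → A * (u′ i c′ * V (suc j) c′) + V (suc j) c * - (u′ i c′ * V zero c′))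
        ≡⟨ sumℚ-distrib-+ (λ c′ → A * (u′ i c′ * V (suc j) c′)) (λ c′ → V (suc j) c * - (u′ i c′ * V zero c′)) ⟩
      sumℚ (λ c′ → A * (u′ i c′ * V (suc j) c′)) + sumℚ (λ c′ → V (suc j) c * - (u′ i c′ * V zero c′))
        ≡⟨ cong₂ _+_ (sumℚ-*ˡ A (λ c′ → u′ i c′ * V (suc j) c′)) (sumℚ-*ˡ (V (suc j) c) (λ c′ → - (u′ i c′ * V zero c′))) ⟩
      A * sumℚ (λ c′ → u′ i c′ * V (suc j) c′) + V (suc j) c * sumℚ (λ c′ → - (u′ i c′ * V zero c′))
        ≡⟨ cong (λ z → A * sumℚ (λ c′ → u′ i c′ * V (suc j) c′) + z)
                (trans (cong (_*_ (V (suc j) c)) (sumℚ-neg (λ c′ → u′ i c′ * V zero c′))) (ℚP.*-comm (V (suc j) c) (x i))) ⟩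
      A * sumℚ (λ c′ → u′ i c′ * V (suc j) c′) + x i * V (suc j) c ∎
      where
      open ℚP.≤-Reasoning
      expand : ∀ u A V Vc V₀ → u * (A * V - Vc * V₀) ≡ A * (u * V) + Vc * - (u * V₀)
      expand = solve 5 (λ u A V Vc V₀ → u :* (A :* V :- Vc :* V₀) := A :* (u :* V) :+ Vc :* (:- (u :* V₀))) refl

    tailDual-dual : ∀ i j → sumℚ (λ c′ → tailDual i c′ * V j c′) ≡ δ (suc i) j
    tailDual-dual i zero    = trans (tailDual-· i zero)
      (solve 2 (λ A S → A :* S :+ (:- S) :* A := con 0ℚ) refl A (sumℚ (λ c′ → u′ i c′ * V zero c′)))
    tailDual-dual i (suc j) = trans (tailDual-· i (suc j)) (trans (sym (u′-·-eliminated i j)) (u′-dual i j))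

    headDual-· : ∀ j → sumℚ (λ c′ → liftDual zero c′ * V j c′) ≡ 1/ A * (V j c - sumℚ (λ i → V (suc i) c * δ (suc i) j))
    headDual-· j = begin-equality
      sumℚ (λ c′ → 1/ A * (δ c c′ - T c′) * V j c′)
        ≡⟨ sumℚ-cong (λ c′ → ℚP.*-assoc (1/ A) _ (V j c′)) ⟩
      sumℚ (λ c′ → 1/ A * ((δ c c′ - T c′) * V j c′))
        ≡⟨ sumℚ-*ˡ (1/ A) (λ c′ → (δ c c′ - T c′) * V j c′) ⟩
      1/ A * sumℚ (λ c′ → (δ c c′ - T c′) * V j c′)
        ≡⟨ cong (_*_ (1/ A)) (trans (sumℚ-cong (λ c′ → distribʳ-- (V j c′) (δ c c′) (T c′)))
                                    (sumℚ-distrib-- (λ c′ → δ c c′ * V j c′) (λ c′ → T c′ * V j c′))) ⟩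
      1/ A * (sumℚ (λ c′ → δ c c′ * V j c′) - sumℚ (λ c′ → T c′ * V j c′))
        ≡⟨ cong₂ (λ y z → 1/ A * (y - z)) (sumℚ-δˡ c (V j)) T·V ⟩
      1/ A * (V j c - sumℚ (λ i → V (suc i) c * δ (suc i) j)) ∎
      where
      open ℚP.≤-Reasoning
      distribʳ-- : ∀ x y z → (y - z) * x ≡ y * x - z * x
      distribʳ-- = solve 3 (λ x y z → (y :- z) :* x := y :* x :- z :* x) refl
      T : Fin m → ℚ
      T c′ = sumℚ (λ i → V (suc i) c * tailDual i c′)
      T·V : sumℚ (λ c′ → T c′ * V j c′) ≡ sumℚ (λ i → V (suc i) c * δ (suc i) j)
      T·V = begin-equality
        sumℚ (λ c′ → T c′ * V j c′)
          ≡⟨ sumℚ-cong (λ c′ → trans (sym (sumℚ-*ʳ (V j c′) (λ i → V (suc i) c * tailDual i c′)))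
                                      (sumℚ-cong (λ i → ℚP.*-assoc (V (suc i) c) (tailDual i c′) (V j c′)))) ⟩
        sumℚ (λ c′ → sumℚ (λ i → V (suc i) c * (tailDual i c′ * V j c′)))
          ≡⟨ sumℚ-comm (λ c′ i → V (suc i) c * (tailDual i c′ * V j c′)) ⟩
        sumℚ (λ i → sumℚ (λ c′ → V (suc i) c * (tailDual i c′ * V j c′)))
          ≡⟨ sumℚ-cong (λ i → trans (sumℚ-*ˡ (V (suc i) c) (λ c′ → tailDual i c′ * V j c′))
                                     (cong (_*_ (V (suc i) c)) (tailDual-dual i j))) ⟩
        sumℚ (λ i → V (suc i) c * δ (suc i) j) ∎

    liftDual-dual : DualFamily V liftDual
    liftDual-dual zero zero = begin-equality
      sumℚ (λ c′ → liftDual zero c′ * V zero c′)             ≡⟨ headDual-· zero ⟩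
      1/ A * (A - sumℚ (λ i → V (suc i) c * 0ℚ))
        ≡⟨ cong (λ z → 1/ A * (A - z)) (trans (sumℚ-cong (λ i → ℚP.*-zeroʳ (V (suc i) c))) (sumℚ-zero k)) ⟩
      1/ A * (A - 0ℚ)                                        ≡⟨ cong (_*_ (1/ A)) (ℚP.+-identityʳ A) ⟩
      1/ A * A                                               ≡⟨ ℚP.*-inverseˡ A ⟩
      1ℚ                                                     ∎
      where open ℚP.≤-Reasoning
    liftDual-dual zero (suc j) = begin-equality
      sumℚ (λ c′ → liftDual zero c′ * V (suc j) c′)                    ≡⟨ headDual-· (suc j) ⟩
      1/ A * (V (suc j) c - sumℚ (λ i → V (suc i) c * δ i j))
        ≡⟨ cong (λ z → 1/ A * (V (suc j) c - z)) (sumℚ-δʳ j (λ i → V (suc i) c)) ⟩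
      1/ A * (V (suc j) c - V (suc j) c)                              ≡⟨ cong (_*_ (1/ A)) (ℚP.+-inverseʳ (V (suc j) c)) ⟩
      1/ A * 0ℚ                                                        ≡⟨ ℚP.*-zeroʳ (1/ A) ⟩
      0ℚ                                                               ∎
      where open ℚP.≤-Reasoning
    liftDual-dual (suc i) j = tailDual-dual i j

linIndep⇒dualFamily : ∀ {m k} (v : Fin k → Fin m → ℤ) → LinIndep v →
                      ∃ λ u → DualFamily (λ j c → toℚ (v j c)) u
linIndep⇒dualFamily {k = zero}  v indep = (λ ()) , (λ ())
linIndep⇒dualFamily {m} {suc k} v indep = liftDual , liftDual-dual
  where
  c : Fin m
  c = proj₁ (linIndep⇒nonzero-coordinate v indep)
  a≢0 : v zero c ≢ + 0
  a≢0 = proj₂ (linIndep⇒nonzero-coordinate v indep)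
  open Elimination v c a≢0
  dual′ : ∃ (DualFamily (λ j c′ → toℚ (eliminated j c′)))
  dual′ = linIndep⇒dualFamily eliminated (linIndep-eliminated indep)
  open Lift (proj₁ dual′) (proj₂ dual′)

∣_∣₁ : ∀ {n} → (Fin n → ℚ) → ℚ
∣ w ∣₁ = sumℚ (λ c → ∣ w c ∣)

∣∣₁-nonNeg : ∀ {n} (w : Fin n → ℚ) → 0ℚ ≤ ∣ w ∣₁
∣∣₁-nonNeg w = sumℚ-nonNeg (λ c → ℚP.0≤∣p∣ (w c))

∣∣≤∣∣₁ : ∀ {n} (w : Fin n → ℚ) c → ∣ w c ∣ ≤ ∣ w ∣₁
∣∣≤∣∣₁ w = ≤-sumℚ (λ c → ℚP.0≤∣p∣ (w c))

_⊥_ : ∀ {n} → (Fin n → ℚ) → (Fin n → ℚ) → Set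
x ⊥ y = sumℚ (λ c → x c * y c) ≡ 0ℚ

dot-bound : ∀ {n} (z w : Fin n → ℚ) {B} → (∀ c → ∣ z c ∣ ≤ B) → ∣ sumℚ (λ c → z c * w c) ∣ ≤ B * ∣ w ∣₁
dot-bound z w {B} ∣z∣≤B = begin
  ∣ sumℚ (λ c → z c * w c) ∣       ≤⟨ ∣sumℚ∣≤sumℚ∣∣ (λ c → z c * w c) ⟩
  sumℚ (λ c → ∣ z c * w c ∣)       ≡⟨ sumℚ-cong (λ c → ℚP.∣p*q∣≡∣p∣*∣q∣ (z c) (w c)) ⟩
  sumℚ (λ c → ∣ z c ∣ * ∣ w c ∣)   ≤⟨ sumℚ-mono-≤ (λ c → *-monoʳ-≤-0≤ (ℚP.0≤∣p∣ (w c)) (∣z∣≤B c)) ⟩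
  sumℚ (λ c → B * ∣ w c ∣)         ≡⟨ sumℚ-*ˡ B (λ c → ∣ w c ∣) ⟩
  B * ∣ w ∣₁                       ∎
  where open ℚP.≤-Reasoning

scaled-dot-bound : ∀ {n} {s} → 0ℚ ≤ s → (z w : Fin n → ℚ) {B : ℚ} → (∀ c → s * ∣ z c ∣ ≤ B) →
                   s * ∣ sumℚ (λ c → z c * w c) ∣ ≤ B * ∣ w ∣₁
scaled-dot-bound {s = s} 0≤s z w {B} s∣z∣≤B = begin
  s * ∣ sumℚ (λ c → z c * w c) ∣     ≡⟨ sym (∣*∣-0≤ 0≤s _) ⟩
  ∣ s * sumℚ (λ c → z c * w c) ∣     ≡⟨ cong ∣_∣ (trans (sym (sumℚ-*ˡ s (λ c → z c * w c)))
                                                     (sumℚ-cong (λ c → sym (ℚP.*-assoc s (z c) (w c))))) ⟩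
  ∣ sumℚ (λ c → (s * z c) * w c) ∣   ≤⟨ dot-bound (λ c → s * z c) w (λ c → ℚP.≤-trans (ℚP.≤-reflexive (∣*∣-0≤ 0≤s (z c))) (s∣z∣≤B c)) ⟩
  B * ∣ w ∣₁                         ∎
  where open ℚP.≤-Reasoning

scaled-triangle : ∀ {s} → 0ℚ ≤ s → ∀ x y → s * ∣ x - y ∣ ≤ s * ∣ x ∣ + s * ∣ y ∣
scaled-triangle {s} 0≤s x y =
  ℚP.≤-trans (*-monoˡ-≤-0≤ 0≤s (ℚP.∣p-q∣≤∣p∣+∣q∣ x y)) (ℚP.≤-reflexive (ℚP.*-distribˡ-+ s ∣ x ∣ ∣ y ∣))

-- y = a P + O(P / s), with the constant K of the O made explicit.
record Approx (s K P y a : ℚ) : Set where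
  constructor approx
  field bound : s * ∣ y - a * P ∣ ≤ K * P

approx-weaken : ∀ {s K K′ P y a} → K ≤ K′ → 0ℚ ≤ P → Approx s K P y a → Approx s K′ P y a
approx-weaken K≤K′ 0≤P (approx y≈aP) = approx (ℚP.≤-trans y≈aP (*-monoʳ-≤-0≤ 0≤P K≤K′))

approx-bounded : ∀ {s K P y a} → 1ℚ ≤ s → 0ℚ ≤ P → Approx s K P y a → ∣ y ∣ ≤ (∣ a ∣ + K) * P
approx-bounded {s} {K} {P} {y} {a} 1≤s 0≤P (approx y≈aP) = begin
  ∣ y ∣                              ≡⟨ cong ∣_∣ (split y (a * P)) ⟩
  ∣ a * P + (y - a * P) ∣            ≤⟨ ℚP.∣p+q∣≤∣p∣+∣q∣ (a * P) (y - a * P) ⟩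
  ∣ a * P ∣ + ∣ y - a * P ∣          ≤⟨ ℚP.+-monoʳ-≤ ∣ a * P ∣ error≤ ⟩
  ∣ a * P ∣ + K * P                  ≡⟨ cong (_+ K * P) (trans (ℚP.∣p*q∣≡∣p∣*∣q∣ a P) (cong (_*_ ∣ a ∣) (ℚP.0≤p⇒∣p∣≡p 0≤P))) ⟩
  ∣ a ∣ * P + K * P                  ≡⟨ sym (ℚP.*-distribʳ-+ P ∣ a ∣ K) ⟩
  (∣ a ∣ + K) * P                    ∎
  where
  open ℚP.≤-Reasoning
  open +-*-Solver
  split : ∀ x y → x ≡ y + (x - y)
  split = solve 2 (λ x y → x := y :+ (x :- y)) refl
  error≤ : ∣ y - a * P ∣ ≤ K * P
  error≤ = begin
    ∣ y - a * P ∣          ≡⟨ sym (ℚP.*-identityˡ _) ⟩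
    1ℚ * ∣ y - a * P ∣     ≤⟨ *-monoʳ-≤-0≤ (ℚP.0≤∣p∣ _) 1≤s ⟩
    s * ∣ y - a * P ∣      ≤⟨ y≈aP ⟩
    K * P                  ∎

approx-dot : ∀ {n s K P} {y a : Fin n → ℚ} → 0ℚ ≤ s → (∀ c → Approx s K P (y c) (a c)) → ∀ w →
             Approx s (K * ∣ w ∣₁) P (sumℚ (λ c → y c * w c)) (sumℚ (λ c → a c * w c))
approx-dot {s = s} {K} {P} {y} {a} 0≤s y≈aP w = approx (begin
  s * ∣ sumℚ (λ c → y c * w c) - sumℚ (λ c → a c * w c) * P ∣  ≡⟨ cong (λ z → s * ∣ z ∣) (sym error-dot) ⟩
  s * ∣ sumℚ (λ c → (y c - a c * P) * w c) ∣
    ≤⟨ scaled-dot-bound 0≤s (λ c → y c - a c * P) w (λ c → Approx.bound (y≈aP c)) ⟩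
  K * P * ∣ w ∣₁                                              ≡⟨ solve 3 (λ K P W → K :* P :* W := K :* W :* P) refl K P ∣ w ∣₁ ⟩
  K * ∣ w ∣₁ * P                                              ∎)
  where
  open ℚP.≤-Reasoning
  open +-*-Solver
  error-dot : sumℚ (λ c → (y c - a c * P) * w c) ≡ sumℚ (λ c → y c * w c) - sumℚ (λ c → a c * w c) * P
  error-dot = begin-equality
    sumℚ (λ c → (y c - a c * P) * w c)
      ≡⟨ sumℚ-cong (λ c → solve 4 (λ y a P w → (y :- a :* P) :* w := y :* w :- (a :* w) :* P) refl (y c) (a c) P (w c)) ⟩
    sumℚ (λ c → y c * w c - (a c * w c) * P)
      ≡⟨ sumℚ-distrib-- (λ c → y c * w c) (λ c → (a c * w c) * P) ⟩
    sumℚ (λ c → y c * w c) - sumℚ (λ c → (a c * w c) * P)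
      ≡⟨ cong (_-_ (sumℚ (λ c → y c * w c))) (sumℚ-*ʳ P (λ c → a c * w c)) ⟩
    sumℚ (λ c → y c * w c) - sumℚ (λ c → a c * w c) * P ∎

approx-zero : ∀ {s K P y} → Approx s K P y 0ℚ → s * ∣ y ∣ ≤ K * P
approx-zero {s} {K} {P} {y} (approx bound) = subst (λ z → s * ∣ z ∣ ≤ K * P) y-0P≡y bound
  where
  open +-*-Solver
  y-0P≡y : y - 0ℚ * P ≡ y
  y-0P≡y = solve 2 (λ y P → y :- con 0ℚ :* P := y) refl y P

approx-dot-⊥ : ∀ {n s K P} {y a : Fin n → ℚ} → 0ℚ ≤ s → (∀ c → Approx s K P (y c) (a c)) → ∀ {w} → a ⊥ w →
               s * ∣ sumℚ (λ c → y c * w c) ∣ ≤ K * ∣ w ∣₁ * P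
approx-dot-⊥ {s = s} {K} {P} {y} 0≤s y≈aP {w} a⊥w =
  approx-zero (subst (Approx s (K * ∣ w ∣₁) P (sumℚ (λ c → y c * w c))) a⊥w (approx-dot 0≤s y≈aP w))

LeadingTerm : (ℕ → Set) → ℕ → ℚ → (ℕ → ℚ) → ℚ → Set
LeadingTerm S D K x a = ∀ t → S t → Approx (fromℕ t) K (fromℕ t ^ D) (x t) a

LeadingTerms : {I : Set} → (ℕ → Set) → ℕ → (I → ℕ → ℚ) → (I → ℚ) → Set
LeadingTerms S D x a = ∃ λ K → 0ℚ ≤ K × (∀ i → LeadingTerm S D K (x i) (a i))

Unbounded : (ℕ → Set) → Set
Unbounded S = ∀ M → ∃ λ t → M ℕ.≤ t × S t

coeffNorm : QPoly → ℚ
coeffNorm []      = 0ℚ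
coeffNorm (a ∷ P) = ∣ a ∣ + coeffNorm P

coeffNorm-nonNeg : ∀ P → 0ℚ ≤ coeffNorm P
coeffNorm-nonNeg []      = ℚP.≤-refl
coeffNorm-nonNeg (a ∷ P) = ℚP.+-mono-≤ (ℚP.0≤∣p∣ a) (coeffNorm-nonNeg P)

DegreeAtMost : QPoly → ℕ → Set
DegreeAtMost P D = ∀ n → D < n → coeffQ P n ≡ 0ℚ

evalQ-zero : ∀ P → (∀ n → coeffQ P n ≡ 0ℚ) → ∀ t → evalQ P t ≡ 0ℚ
evalQ-zero []      _    t = refl
evalQ-zero (a ∷ P) P≡0 t = begin-equality
  a + fromℕ t * evalQ P t   ≡⟨ cong₂ (λ x y → x + fromℕ t * y) (P≡0 zero) (evalQ-zero P (λ n → P≡0 (suc n)) t) ⟩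
  0ℚ + fromℕ t * 0ℚ         ≡⟨ cong (_+_ 0ℚ) (ℚP.*-zeroʳ (fromℕ t)) ⟩
  0ℚ                        ∎
  where open ℚP.≤-Reasoning

polynomial-approx : ∀ P D → DegreeAtMost P D → ∀ t → 1 ℕ.≤ t →
                    Approx (fromℕ t) (coeffNorm P) (fromℕ t ^ D) (evalQ P t) (coeffQ P D)
polynomial-approx [] D _ t _ = approx (ℚP.≤-reflexive (begin-equality
  fromℕ t * ∣ 0ℚ - 0ℚ * fromℕ t ^ D ∣   ≡⟨ cong (λ z → fromℕ t * ∣ 0ℚ - z ∣) (ℚP.*-zeroˡ (fromℕ t ^ D)) ⟩
  fromℕ t * 0ℚ                          ≡⟨ ℚP.*-zeroʳ (fromℕ t) ⟩
  0ℚ                                    ≡⟨ sym (ℚP.*-zeroˡ (fromℕ t ^ D)) ⟩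
  0ℚ * fromℕ t ^ D                      ∎))
  where open ℚP.≤-Reasoning
polynomial-approx (a ∷ P) zero deg≤0 t _ = approx (begin
  s * ∣ a + s * evalQ P t - a * 1ℚ ∣    ≡⟨ cong (λ z → s * ∣ a + s * z - a * 1ℚ ∣) (evalQ-zero P (λ n → deg≤0 (suc n) (ℕ.s≤s ℕ.z≤n)) t) ⟩
  s * ∣ a + s * 0ℚ - a * 1ℚ ∣           ≡⟨ cong (λ z → s * ∣ z ∣) (solve 2 (λ a s → a :+ s :* con 0ℚ :- a :* con 1ℚ := con 0ℚ) refl a s) ⟩
  s * 0ℚ                                ≡⟨ ℚP.*-zeroʳ s ⟩
  0ℚ                                    ≤⟨ 0≤-* (coeffNorm-nonNeg (a ∷ P)) 0≤1 ⟩
  coeffNorm (a ∷ P) * 1ℚ                ∎)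
  where
  s : ℚ
  s = fromℕ t
  open ℚP.≤-Reasoning
  open +-*-Solver
polynomial-approx (a ∷ P) (suc D) deg≤D+1 t 1≤t = approx (begin
  s * ∣ a + s * evalQ P t - c * (s * sᴰ) ∣
    ≡⟨ cong (λ z → s * ∣ z ∣) (solve 5 (λ a s y c p → a :+ s :* y :- c :* (s :* p) := a :+ s :* (y :- c :* p)) refl a s (evalQ P t) c sᴰ) ⟩
  s * ∣ a + s * E ∣                            ≤⟨ *-monoˡ-≤-0≤ 0≤s (ℚP.∣p+q∣≤∣p∣+∣q∣ a (s * E)) ⟩
  s * (∣ a ∣ + ∣ s * E ∣)                       ≡⟨ cong (λ z → s * (∣ a ∣ + z)) (∣*∣-0≤ 0≤s E) ⟩
  s * (∣ a ∣ + s * ∣ E ∣)                       ≡⟨ ℚP.*-distribˡ-+ s ∣ a ∣ _ ⟩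
  s * ∣ a ∣ + s * (s * ∣ E ∣)
    ≤⟨ ℚP.+-mono-≤ s∣a∣≤ (*-monoˡ-≤-0≤ 0≤s (Approx.bound tail≈)) ⟩
  ∣ a ∣ * (s * sᴰ) + s * (coeffNorm P * sᴰ)
    ≡⟨ solve 4 (λ a s p C → a :* (s :* p) :+ s :* (C :* p) := (a :+ C) :* (s :* p)) refl ∣ a ∣ s sᴰ (coeffNorm P) ⟩
  (∣ a ∣ + coeffNorm P) * (s * sᴰ)              ∎)
  where
  open ℚP.≤-Reasoning
  open +-*-Solver
  s sᴰ c E : ℚ
  s  = fromℕ t
  sᴰ = s ^ D
  c  = coeffQ P D
  E  = evalQ P t - c * sᴰ
  0≤s : 0ℚ ≤ s
  0≤s = fromℕ-nonNeg t
  tail≈ : Approx s (coeffNorm P) sᴰ (evalQ P t) c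
  tail≈ = polynomial-approx P D (λ n D<n → deg≤D+1 (suc n) (ℕ.s≤s D<n)) t 1≤t
  s∣a∣≤ : s * ∣ a ∣ ≤ ∣ a ∣ * (s * sᴰ)
  s∣a∣≤ = begin
    s * ∣ a ∣            ≡⟨ trans (ℚP.*-comm s ∣ a ∣) (cong (_*_ ∣ a ∣) (sym (ℚP.*-identityʳ s))) ⟩
    ∣ a ∣ * (s * 1ℚ)     ≤⟨ *-monoˡ-≤-0≤ (ℚP.0≤∣p∣ a) (*-monoˡ-≤-0≤ 0≤s (1≤^ D (fromℕ-mono-≤ 1≤t))) ⟩
    ∣ a ∣ * (s * sᴰ)     ∎

polynomial-leadingTerm : ∀ {S} P D → DegreeAtMost P D → LeadingTerm S D (coeffNorm P) (evalQ P) (coeffQ P D)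
polynomial-leadingTerm P D deg≤D zero    _ = approx (begin
  0ℚ * ∣ evalQ P 0 - coeffQ P D * 0ℚ ^ D ∣  ≡⟨ ℚP.*-zeroˡ ∣ evalQ P 0 - coeffQ P D * 0ℚ ^ D ∣ ⟩
  0ℚ                                        ≤⟨ 0≤-* (coeffNorm-nonNeg P) (^-nonNeg D ℚP.≤-refl) ⟩
  coeffNorm P * 0ℚ ^ D                      ∎)
  where open ℚP.≤-Reasoning
polynomial-leadingTerm P D deg≤D (suc t) _ = polynomial-approx P D deg≤D (suc t) (ℕ.s≤s ℕ.z≤n)

leadingTerms-uniform : ∀ {I : Set} {S D k} {x : Fin k → I → ℕ → ℚ} {a : Fin k → I → ℚ} →
                       (∀ j → LeadingTerms S D (x j) (a j)) → LeadingTerms S D (uncurry x) (uncurry a)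
leadingTerms-uniform {D = D} {k} x≈a =
  sumℚ K , sumℚ-nonNeg 0≤K ,
  λ (j , i) t St → approx-weaken (≤-sumℚ 0≤K j) (^-nonNeg D (fromℕ-nonNeg t)) (proj₂ (proj₂ (x≈a j)) i t St)
  where
  K : Fin k → ℚ
  K j = proj₁ (x≈a j)
  0≤K : ∀ j → 0ℚ ≤ K j
  0≤K j = proj₁ (proj₂ (x≈a j))

leadingTerms-fromEach : ∀ {m S D} {x : Fin m → ℕ → ℚ} {a : Fin m → ℚ} →
                        (∀ c → ∃ λ K → 0ℚ ≤ K × LeadingTerm S D K (x c) (a c)) → LeadingTerms S D x a
leadingTerms-fromEach {m} {D = D} x≈a =
  sumℚ K , sumℚ-nonNeg 0≤K ,
  λ c t St → approx-weaken (≤-sumℚ 0≤K c) (^-nonNeg D (fromℕ-nonNeg t)) (proj₂ (proj₂ (x≈a c)) t St)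
  where
  K : Fin m → ℚ
  K c = proj₁ (x≈a c)
  0≤K : ∀ c → 0ℚ ≤ K c
  0≤K c = proj₁ (proj₂ (x≈a c))

leadingTerms-cong : ∀ {I : Set} {S D} {x y : I → ℕ → ℚ} {a : I → ℚ} →
                    (∀ i t → x i t ≡ y i t) → LeadingTerms S D x a → LeadingTerms S D y a
leadingTerms-cong {D = D} {a = a} x≡y (K , 0≤K , x≈a) =
  K , 0≤K , λ i t St → subst (λ z → Approx (fromℕ t) K (fromℕ t ^ D) z (a i)) (x≡y i t) (x≈a i t St)

dualNorm : ∀ {m k} → (Fin k → Fin m → ℚ) → ℚ
dualNorm u = sumℚ (λ i → ∣ u i ∣₁)

∣∣₁≤dualNorm : ∀ {m k} (u : Fin k → Fin m → ℚ) i → ∣ u i ∣₁ ≤ dualNorm u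
∣∣₁≤dualNorm u = ≤-sumℚ (λ i → ∣∣₁-nonNeg (u i))

module CoefficientBound {m k} {V : Fin k → Fin m → ℚ} {u : Fin k → Fin m → ℚ} (u-dual : DualFamily V u)
  {s KF P : ℚ} (0≤s : 0ℚ ≤ s) (0≤KF : 0ℚ ≤ KF) (0≤P : 0ℚ ≤ P)
  (F : Fin k → Fin m → ℚ) (F≈VP : ∀ j c → Approx s KF P (F j c) (V j c)) (ν : Fin k → ℚ) where

  U : ℚ
  U = dualNorm u

  combination : Fin m → ℚ
  combination c = sumℚ (λ j → ν j * F j c)

  error : Fin k → Fin k → ℚ
  error i j = sumℚ (λ c → (F j c - V j c * P) * u i c)

  error-bound : ∀ i j → s * ∣ error i j ∣ ≤ KF * P * U
  error-bound i j = ℚP.≤-trans (scaled-dot-bound 0≤s (λ c → F j c - V j c * P) (u i) (λ c → Approx.bound (F≈VP j c)))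
                               (*-monoˡ-≤-0≤ (0≤-* 0≤KF 0≤P) (∣∣₁≤dualNorm u i))

  dual-coordinate : ∀ i → sumℚ (λ c → combination c * u i c) ≡ sumℚ (λ j → error i j * ν j) + P * ν i
  dual-coordinate i = begin-equality
    sumℚ (λ c → combination c * u i c)
      ≡⟨ sumℚ-cong (λ c → sym (sumℚ-*ʳ (u i c) (λ j → ν j * F j c))) ⟩
    sumℚ (λ c → sumℚ (λ j → ν j * F j c * u i c))
      ≡⟨ sumℚ-comm (λ c j → ν j * F j c * u i c) ⟩
    sumℚ (λ j → sumℚ (λ c → ν j * F j c * u i c))
      ≡⟨ sumℚ-cong term ⟩
    sumℚ (λ j → error i j * ν j + δ i j * (P * ν j))
      ≡⟨ sumℚ-distrib-+ (λ j → error i j * ν j) (λ j → δ i j * (P * ν j)) ⟩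
    sumℚ (λ j → error i j * ν j) + sumℚ (λ j → δ i j * (P * ν j))
      ≡⟨ cong (_+_ (sumℚ (λ j → error i j * ν j))) (sumℚ-δˡ i (λ j → P * ν j)) ⟩
    sumℚ (λ j → error i j * ν j) + P * ν i ∎
    where
    open ℚP.≤-Reasoning
    open +-*-Solver
    term : ∀ j → sumℚ (λ c → ν j * F j c * u i c) ≡ error i j * ν j + δ i j * (P * ν j)
    term j = begin-equality
      sumℚ (λ c → ν j * F j c * u i c)
        ≡⟨ sumℚ-cong (λ c → solve 5 (λ n f u v p → n :* f :* u := (f :- v :* p) :* u :* n :+ u :* v :* (p :* n)) refl
                                     (ν j) (F j c) (u i c) (V j c) P) ⟩
      sumℚ (λ c → (F j c - V j c * P) * u i c * ν j + u i c * V j c * (P * ν j))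
        ≡⟨ sumℚ-distrib-+ (λ c → (F j c - V j c * P) * u i c * ν j) (λ c → u i c * V j c * (P * ν j)) ⟩
      sumℚ (λ c → (F j c - V j c * P) * u i c * ν j) + sumℚ (λ c → u i c * V j c * (P * ν j))
        ≡⟨ cong₂ _+_ (sumℚ-*ʳ (ν j) (λ c → (F j c - V j c * P) * u i c))
                     (trans (sumℚ-*ʳ (P * ν j) (λ c → u i c * V j c)) (cong (_* (P * ν j)) (u-dual i j))) ⟩
      error i j * ν j + δ i j * (P * ν j) ∎

  ν-bound : ∀ {Y} → 0ℚ ≤ Y → (∀ c → ∣ combination c ∣ ≤ Y) →
            ∀ i → s * (P * ∣ ν i ∣) ≤ s * (Y * U) + KF * P * U * ∣ ν ∣₁
  ν-bound {Y} 0≤Y ∣comb∣≤Y i = begin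
    s * (P * ∣ ν i ∣)          ≡⟨ cong (_*_ s) (sym (∣*∣-0≤ 0≤P (ν i))) ⟩
    s * ∣ P * ν i ∣            ≡⟨ cong (λ z → s * ∣ z ∣) (isolate (dual-coordinate i)) ⟩
    s * ∣ y - errors ∣         ≤⟨ scaled-triangle 0≤s y errors ⟩
    s * ∣ y ∣ + s * ∣ errors ∣ ≤⟨ ℚP.+-mono-≤ (*-monoˡ-≤-0≤ 0≤s y-bound)
                                             (scaled-dot-bound 0≤s (error i) ν (error-bound i)) ⟩
    s * (Y * U) + KF * P * U * ∣ ν ∣₁ ∎
    where
    open ℚP.≤-Reasoning
    open +-*-Solver
    y errors : ℚ
    y = sumℚ (λ c → combination c * u i c)
    errors = sumℚ (λ j → error i j * ν j)
    isolate : y ≡ errors + P * ν i → P * ν i ≡ y - errors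
    isolate y≡ = trans (solve 2 (λ e x → x := e :+ x :- e) refl errors (P * ν i)) (cong (_- errors) (sym y≡))
    y-bound : ∣ y ∣ ≤ Y * U
    y-bound = ℚP.≤-trans (dot-bound combination (u i) ∣comb∣≤Y)
                         (*-monoˡ-≤-0≤ 0≤Y (∣∣₁≤dualNorm u i))

  -- Above the threshold on s the error term of `summed` is at most half of its left side.
  coefficient-bound : ∀ {Y} → 0ℚ ≤ Y → (∀ c → ∣ combination c ∣ ≤ Y) →
                      1ℚ ≤ s → fromℕ k * (KF * U) + fromℕ k * (KF * U) ≤ s →
                      P * ∣ ν ∣₁ ≤ (fromℕ k * U + fromℕ k * U) * Y
  coefficient-bound {Y} 0≤Y ∣comb∣≤Y 1≤s threshold≤s = ℚP.*-cancelˡ-≤-pos s {{1≤⇒positive 1≤s}} (begin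
    s * (P * ∣ ν ∣₁)                ≤⟨ ≤-absorb {b = k′ * (s * (Y * U))} summed absorbed ⟩
    k′ * (s * (Y * U)) + k′ * (s * (Y * U))
      ≡⟨ solve 4 (λ k s Y U → k :* (s :* (Y :* U)) :+ k :* (s :* (Y :* U)) := s :* ((k :* U :+ k :* U) :* Y)) refl k′ s Y U ⟩
    s * ((k′ * U + k′ * U) * Y)     ∎)
    where
    open ℚP.≤-Reasoning
    open +-*-Solver
    k′ : ℚ
    k′ = fromℕ k
    summed : s * (P * ∣ ν ∣₁) ≤ k′ * (s * (Y * U)) + k′ * (KF * P * U * ∣ ν ∣₁)
    summed = begin
      s * (P * ∣ ν ∣₁)                                  ≡⟨ cong (_*_ s) (sym (sumℚ-*ˡ P (λ j → ∣ ν j ∣))) ⟩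
      s * sumℚ (λ j → P * ∣ ν j ∣)                      ≡⟨ sym (sumℚ-*ˡ s (λ j → P * ∣ ν j ∣)) ⟩
      sumℚ (λ j → s * (P * ∣ ν j ∣))                    ≤⟨ sumℚ-mono-≤ (ν-bound 0≤Y ∣comb∣≤Y) ⟩
      sumℚ {k} (λ _ → s * (Y * U) + KF * P * U * ∣ ν ∣₁) ≡⟨ sumℚ-const k _ ⟩
      k′ * (s * (Y * U) + KF * P * U * ∣ ν ∣₁)           ≡⟨ ℚP.*-distribˡ-+ k′ _ _ ⟩
      k′ * (s * (Y * U)) + k′ * (KF * P * U * ∣ ν ∣₁)   ∎
    absorbed : k′ * (KF * P * U * ∣ ν ∣₁) + k′ * (KF * P * U * ∣ ν ∣₁) ≤ s * (P * ∣ ν ∣₁)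
    absorbed = begin
      k′ * (KF * P * U * ∣ ν ∣₁) + k′ * (KF * P * U * ∣ ν ∣₁)
        ≡⟨ solve 5 (λ k K P U N → k :* (K :* P :* U :* N) :+ k :* (K :* P :* U :* N) := (k :* (K :* U) :+ k :* (K :* U)) :* (P :* N)) refl k′ KF P U ∣ ν ∣₁ ⟩
      (k′ * (KF * U) + k′ * (KF * U)) * (P * ∣ ν ∣₁)
        ≤⟨ *-monoʳ-≤-0≤ (0≤-* 0≤P (∣∣₁-nonNeg ν)) threshold≤s ⟩
      s * (P * ∣ ν ∣₁) ∎

module PilotEstimate {m k} {V : Fin k → Fin m → ℚ} {u : Fin k → Fin m → ℚ} (u-dual : DualFamily V u)
  {π p w : Fin m → ℚ} (V⊥w : ∀ j → V j ⊥ w) (π⊥w : π ⊥ w)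
  {KF KH KG : ℚ} (0≤KF : 0ℚ ≤ KF) (0≤KH : 0ℚ ≤ KH) (0≤KG : 0ℚ ≤ KG) where

  Y Z K threshold : ℚ
  Y = ∣ π ∣₁ + KH + (∣ p ∣₁ + KG)
  Z = (fromℕ k * dualNorm u + fromℕ k * dualNorm u) * Y
  K = KH * ∣ w ∣₁ + KF * ∣ w ∣₁ * Z + KG * ∣ w ∣₁
  threshold = fromℕ k * (KF * dualNorm u) + fromℕ k * (KF * dualNorm u)

  0≤Y : 0ℚ ≤ Y
  0≤Y = ℚP.+-mono-≤ (ℚP.+-mono-≤ (∣∣₁-nonNeg π) 0≤KH) (ℚP.+-mono-≤ (∣∣₁-nonNeg p) 0≤KG)

  module _ {s Pd Pe : ℚ} (1≤s : 1ℚ ≤ s) (0≤Pd : 0ℚ ≤ Pd) (1≤Pe : 1ℚ ≤ Pe)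
    (F : Fin k → Fin m → ℚ) (H : Fin m → ℚ) (ν : Fin k → ℚ)
    (F≈VPd : ∀ j c → Approx s KF Pd (F j c) (V j c))
    (H≈πPe : ∀ c → Approx s KH Pe (H c) (π c))
    (G≈pPe : ∀ c → Approx s KG Pe (H c - sumℚ (λ j → ν j * F j c)) (p c)) where

    open +-*-Solver
    0≤s : 0ℚ ≤ s
    0≤s = ℚP.≤-trans 0≤1 1≤s
    0≤Pe : 0ℚ ≤ Pe
    0≤Pe = ℚP.≤-trans 0≤1 1≤Pe
    open CoefficientBound {V = V} {u = u} u-dual 0≤s 0≤KF 0≤Pd F F≈VPd ν using (combination; coefficient-bound)

    G : Fin m → ℚ
    G c = H c - combination c

    combination-bound : ∀ c → ∣ combination c ∣ ≤ Y * Pe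
    combination-bound c = begin
      ∣ combination c ∣                         ≡⟨ cong ∣_∣ (solve 2 (λ h g → g := h :- (h :- g)) refl (H c) (combination c)) ⟩
      ∣ H c - G c ∣                             ≤⟨ ℚP.∣p-q∣≤∣p∣+∣q∣ (H c) (G c) ⟩
      ∣ H c ∣ + ∣ G c ∣                         ≤⟨ ℚP.+-mono-≤ (approx-bounded 1≤s 0≤Pe (H≈πPe c)) (approx-bounded 1≤s 0≤Pe (G≈pPe c)) ⟩
      (∣ π c ∣ + KH) * Pe + (∣ p c ∣ + KG) * Pe ≡⟨ sym (ℚP.*-distribʳ-+ Pe (∣ π c ∣ + KH) (∣ p c ∣ + KG)) ⟩
      (∣ π c ∣ + KH + (∣ p c ∣ + KG)) * Pe
        ≤⟨ *-monoʳ-≤-0≤ 0≤Pe (ℚP.+-mono-≤ (ℚP.+-monoˡ-≤ KH (∣∣≤∣∣₁ π c)) (ℚP.+-monoˡ-≤ KG (∣∣≤∣∣₁ p c))) ⟩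
      Y * Pe                                   ∎
      where open ℚP.≤-Reasoning

    G·w-expansion : sumℚ (λ c → G c * w c) ≡ sumℚ (λ c → H c * w c) - sumℚ (λ j → sumℚ (λ c → F j c * w c) * ν j)
    G·w-expansion = begin-equality
      sumℚ (λ c → G c * w c)
        ≡⟨ sumℚ-cong (λ c → ℚP.*-distribʳ-+ (w c) (H c) (- combination c)) ⟩
      sumℚ (λ c → H c * w c + - combination c * w c)
        ≡⟨ sumℚ-distrib-+ (λ c → H c * w c) (λ c → - combination c * w c) ⟩
      sumℚ (λ c → H c * w c) + sumℚ (λ c → - combination c * w c)
        ≡⟨ cong (_+_ (sumℚ (λ c → H c * w c)))
                (trans (sumℚ-cong (λ c → sym (ℚP.neg-distribˡ-* (combination c) (w c)))) (sumℚ-neg (λ c → combination c * w c))) ⟩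
      sumℚ (λ c → H c * w c) - sumℚ (λ c → combination c * w c)
        ≡⟨ cong (_-_ (sumℚ (λ c → H c * w c))) regroup ⟩
      sumℚ (λ c → H c * w c) - sumℚ (λ j → sumℚ (λ c → F j c * w c) * ν j) ∎
      where
      open ℚP.≤-Reasoning
      regroup : sumℚ (λ c → combination c * w c) ≡ sumℚ (λ j → sumℚ (λ c → F j c * w c) * ν j)
      regroup = begin-equality
        sumℚ (λ c → combination c * w c)          ≡⟨ sumℚ-cong (λ c → sym (sumℚ-*ʳ (w c) (λ j → ν j * F j c))) ⟩
        sumℚ (λ c → sumℚ (λ j → ν j * F j c * w c)) ≡⟨ sumℚ-comm (λ c j → ν j * F j c * w c) ⟩
        sumℚ (λ j → sumℚ (λ c → ν j * F j c * w c))
          ≡⟨ sumℚ-cong (λ j → trans (sumℚ-cong (λ c → solve 3 (λ n f w → n :* f :* w := f :* w :* n) refl (ν j) (F j c) (w c)))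
                                    (sumℚ-*ʳ (ν j) (λ c → F j c * w c))) ⟩
        sumℚ (λ j → sumℚ (λ c → F j c * w c) * ν j) ∎

    module _ (threshold≤s : threshold ≤ s) where

      Pd∣ν∣≤ZPe : Pd * ∣ ν ∣₁ ≤ Z * Pe
      Pd∣ν∣≤ZPe = ℚP.≤-trans (coefficient-bound (0≤-* 0≤Y 0≤Pe) combination-bound 1≤s threshold≤s)
                             (ℚP.≤-reflexive (sym (ℚP.*-assoc (fromℕ k * dualNorm u + fromℕ k * dualNorm u) Y Pe)))

      G·w-bound : s * ∣ sumℚ (λ c → G c * w c) ∣ ≤ (KH * ∣ w ∣₁ + KF * ∣ w ∣₁ * Z) * Pe
      G·w-bound = begin
        s * ∣ sumℚ (λ c → G c * w c) ∣               ≡⟨ cong (λ z → s * ∣ z ∣) G·w-expansion ⟩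
        s * ∣ H·w - sumℚ (λ j → F·w j * ν j) ∣       ≤⟨ scaled-triangle 0≤s H·w _ ⟩
        s * ∣ H·w ∣ + s * ∣ sumℚ (λ j → F·w j * ν j) ∣
          ≤⟨ ℚP.+-mono-≤ (approx-dot-⊥ 0≤s H≈πPe π⊥w) (scaled-dot-bound 0≤s F·w ν (λ j → approx-dot-⊥ 0≤s (F≈VPd j) (V⊥w j))) ⟩
        KH * ∣ w ∣₁ * Pe + KF * ∣ w ∣₁ * Pd * ∣ ν ∣₁  ≡⟨ cong (_+_ (KH * ∣ w ∣₁ * Pe)) (ℚP.*-assoc (KF * ∣ w ∣₁) Pd ∣ ν ∣₁) ⟩
        KH * ∣ w ∣₁ * Pe + KF * ∣ w ∣₁ * (Pd * ∣ ν ∣₁)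
          ≤⟨ ℚP.+-monoʳ-≤ (KH * ∣ w ∣₁ * Pe) (*-monoˡ-≤-0≤ (0≤-* 0≤KF (∣∣₁-nonNeg w)) Pd∣ν∣≤ZPe) ⟩
        KH * ∣ w ∣₁ * Pe + KF * ∣ w ∣₁ * (Z * Pe)
          ≡⟨ solve 5 (λ a W P b Z → a :* W :* P :+ b :* W :* (Z :* P) := (a :* W :+ b :* W :* Z) :* P) refl KH ∣ w ∣₁ Pe KF Z ⟩
        (KH * ∣ w ∣₁ + KF * ∣ w ∣₁ * Z) * Pe          ∎
        where
        open ℚP.≤-Reasoning
        H·w : ℚ
        H·w = sumℚ (λ c → H c * w c)
        F·w : Fin k → ℚ
        F·w j = sumℚ (λ c → F j c * w c)

      pilot-dot-bound : s * ∣ sumℚ (λ c → p c * w c) ∣ ≤ K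
      pilot-dot-bound = ℚP.*-cancelʳ-≤-pos Pe {{1≤⇒positive 1≤Pe}} (begin
        s * ∣ p·w ∣ * Pe                              ≡⟨ trans (ℚP.*-assoc s _ Pe) (cong (_*_ s) (sym ∣p·wPe∣)) ⟩
        s * ∣ G·w - (G·w - p·w * Pe) ∣                ≤⟨ scaled-triangle 0≤s G·w _ ⟩
        s * ∣ G·w ∣ + s * ∣ G·w - p·w * Pe ∣          ≤⟨ ℚP.+-mono-≤ G·w-bound (Approx.bound (approx-dot 0≤s G≈pPe w)) ⟩
        (KH * ∣ w ∣₁ + KF * ∣ w ∣₁ * Z) * Pe + KG * ∣ w ∣₁ * Pe ≡⟨ sym (ℚP.*-distribʳ-+ Pe (KH * ∣ w ∣₁ + KF * ∣ w ∣₁ * Z) (KG * ∣ w ∣₁)) ⟩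
        (KH * ∣ w ∣₁ + KF * ∣ w ∣₁ * Z + KG * ∣ w ∣₁) * Pe    ∎)
        where
        open ℚP.≤-Reasoning
        G·w p·w : ℚ
        G·w = sumℚ (λ c → G c * w c)
        p·w = sumℚ (λ c → p c * w c)
        ∣p·wPe∣ : ∣ G·w - (G·w - p·w * Pe) ∣ ≡ ∣ p·w ∣ * Pe
        ∣p·wPe∣ = begin-equality
          ∣ G·w - (G·w - p·w * Pe) ∣  ≡⟨ cong ∣_∣ (solve 3 (λ g x P → g :- (g :- x :* P) := x :* P) refl G·w p·w Pe) ⟩
          ∣ p·w * Pe ∣                ≡⟨ ℚP.∣p*q∣≡∣p∣*∣q∣ p·w Pe ⟩
          ∣ p·w ∣ * ∣ Pe ∣            ≡⟨ cong (_*_ ∣ p·w ∣) (ℚP.0≤p⇒∣p∣≡p 0≤Pe) ⟩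
          ∣ p·w ∣ * Pe                ∎

leadingCoefficient-orthogonal :
  ∀ {m k d e} {S : ℕ → Set} → Unbounded S →
  {V : Fin k → Fin m → ℚ} {u : Fin k → Fin m → ℚ} → DualFamily V u →
  {π p w : Fin m → ℚ} → (∀ j → V j ⊥ w) → π ⊥ w →
  (F : Fin k → Fin m → ℕ → ℚ) (H : Fin m → ℕ → ℚ) (ν : Fin k → ℕ → ℚ) →
  (∀ j → LeadingTerms S d (F j) (V j)) → LeadingTerms S e H π →
  LeadingTerms S e (λ c t → H c t - sumℚ (λ j → ν j t * F j c t)) p →
  p ⊥ w
leadingCoefficient-orthogonal {k = k} {d} {e} {S} S-unbounded {u = u} u-dual {π} {p} {w} V⊥w π⊥w F H ν F≈
                              (KH , 0≤KH , H≈) (KG , 0≤KG , G≈)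
  with leadingTerms-uniform {S = S} {D = d} F≈
... | KF , 0≤KF , F≈VPd = archimedean-zero large-t
  where
  open PilotEstimate {u = u} u-dual {π} {p} V⊥w π⊥w 0≤KF 0≤KH 0≤KG using (K; threshold; pilot-dot-bound)
  T₀ : ℕ
  T₀ = proj₁ (archimedean threshold)
  large-t : ∀ M → ∃ λ t → M ℕ.≤ t × fromℕ t * ∣ sumℚ (λ c → p c * w c) ∣ ≤ K
  large-t M with S-unbounded (suc (M ℕ.+ T₀))
  ... | t , M+T₀<t , St = t , M≤t , pilot-dot-bound 1≤s (^-nonNeg d (fromℕ-nonNeg t)) (1≤^ e 1≤s)
          (λ j c → F j c t) (λ c → H c t) (λ j → ν j t)
          (λ j c → F≈VPd (j , c) t St) (λ c → H≈ c t St) (λ c → G≈ c t St) threshold≤s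
    where
    M≤t : M ℕ.≤ t
    M≤t = ℕP.≤-trans (ℕP.m≤m+n M T₀) (ℕP.<⇒≤ M+T₀<t)
    1≤s : 1ℚ ≤ fromℕ t
    1≤s = fromℕ-mono-≤ (ℕP.≤-trans (ℕ.s≤s ℕ.z≤n) M+T₀<t)
    threshold≤s : threshold ≤ fromℕ t
    threshold≤s = ℚP.≤-trans (proj₂ (archimedean threshold)) (fromℕ-mono-≤ (ℕP.≤-trans (ℕP.m≤n+m T₀ M) (ℕP.<⇒≤ M+T₀<t)))

toQPoly : ZPoly → QPoly
toQPoly []      = []
toQPoly (a ∷ p) = toℚ a ∷ toQPoly p

coeffQ-toQPoly : ∀ p n → coeffQ (toQPoly p) n ≡ toℚ (coeff p n)
coeffQ-toQPoly []      n       = refl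
coeffQ-toQPoly (a ∷ p) zero    = refl
coeffQ-toQPoly (a ∷ p) (suc n) = coeffQ-toQPoly p n

evalQ-toQPoly : ∀ p t → evalQ (toQPoly p) t ≡ toℚ (eval p t)
evalQ-toQPoly []      t = refl
evalQ-toQPoly (a ∷ p) t = sym (begin-equality
  toℚ (a ℤ.+ + t ℤ.* eval p t)          ≡⟨ toℚ-+ a _ ⟩
  toℚ a + toℚ (+ t ℤ.* eval p t)        ≡⟨ cong (_+_ (toℚ a)) (toℚ-* (+ t) (eval p t)) ⟩
  toℚ a + fromℕ t * toℚ (eval p t)      ≡⟨ cong (λ z → toℚ a + fromℕ t * z) (sym (evalQ-toQPoly p t)) ⟩
  toℚ a + fromℕ t * evalQ (toQPoly p) t ∎)
  where open ℚP.≤-Reasoning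

vDeg⇒leadingTerms : ∀ {m S D} {v : ZVec m} → VDeg v D →
                    LeadingTerms S D (λ c t → toℚ (eval (v c) t)) (λ c → toℚ (pilot v D c))
vDeg⇒leadingTerms {m} {S} {D} {v} (deg≤D , _) = leadingTerms-fromEach {D = D} λ c →
  coeffNorm (toQPoly (v c)) , coeffNorm-nonNeg (toQPoly (v c)) , λ t St →
    subst₂ (Approx (fromℕ t) (coeffNorm (toQPoly (v c))) (fromℕ t ^ D)) (evalQ-toQPoly (v c) t) (coeffQ-toQPoly (v c) D)
      (polynomial-leadingTerm {S = S} (toQPoly (v c)) D (λ n D<n → trans (coeffQ-toQPoly (v c) n) (cong toℚ (deg≤D c n D<n))) t St)

eqpDegPilot⇒leadingTerms : ∀ {m D} {g : ℕ → Fin m → ℤ} {p : Fin m → ℚ} → EQPDegPilot g D p →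
                           ∃ λ S → Unbounded S × LeadingTerms S D (λ c t → toℚ (g t c)) p
eqpDegPilot⇒leadingTerms {m} {D} {g} {p} (_ , n , T , P , g≡P , P-coeffs) =
  S , S-unbounded , leadingTerms-fromEach {D = D} λ c → coeffNorm (P 0 c) , coeffNorm-nonNeg (P 0 c) , g≈ c
  where
  S : ℕ → Set
  S t = T ℕ.≤ t × t % suc n ≡ 0
  S-unbounded : Unbounded S
  S-unbounded M = (M ℕ.+ T) ℕ.* suc n
                , ℕP.≤-trans (ℕP.m≤m+n M T) (ℕP.m≤m*n (M ℕ.+ T) (suc n))
                , ℕP.≤-trans (ℕP.m≤n+m T M) (ℕP.m≤m*n (M ℕ.+ T) (suc n))
                , m*n%n≡0 (M ℕ.+ T) (suc n)
  g≈ : ∀ c → LeadingTerm S D (coeffNorm (P 0 c)) (λ t → toℚ (g t c)) (p c)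
  g≈ c t St@(T≤t , t%N≡0) =
    subst₂ (Approx (fromℕ t) (coeffNorm (P 0 c)) (fromℕ t ^ D))
      (sym (trans (g≡P t T≤t c) (cong (λ r → evalQ (P r c) t) t%N≡0))) (proj₂ (P-coeffs 0 (ℕ.s≤s ℕ.z≤n) c))
      (polynomial-leadingTerm {S = S} (P 0 c) D (proj₁ (P-coeffs 0 (ℕ.s≤s ℕ.z≤n) c)) t St)

toℚ-hPrime : ∀ {m k} (f : Fin k → ZVec m) h α t c →
             toℚ (hPrime f h α t c) ≡ toℚ (eval (h c) t) - sumℚ (λ j → toℚ (nearest (evalRat (α j) t)) * toℚ (eval (f j c) t))
toℚ-hPrime {k = k} f h α t c = trans (toℚ-+ (eval (h c) t) _) (cong (_+_ (toℚ (eval (h c) t)))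
  (trans (toℚ-neg (sumℤ combination)) (cong -_ (trans (toℚ-sumℤ combination)
    (sumℚ-cong (λ j → toℚ-* (nearest (evalRat (α j) t)) (eval (f j c) t)))))))
  where
  combination : Fin k → ℤ
  combination j = nearest (evalRat (α j) t) ℤ.* eval (f j c) t

asymOrth⇒⊥ : ∀ {m} {u v : ZVec m} {D D′} → VDeg u D → VDeg v D′ → AsymOrth u v →
             (λ c → toℚ (pilot u D c)) ⊥ (λ c → toℚ (pilot v D′ c))
asymOrth⇒⊥ {u = u} {v} {D} {D′} u-deg v-deg u⊥v =
  trans (sym (toℚ-dotℤ (pilot u D) (pilot v D′))) (cong toℚ (u⊥v D D′ u-deg v-deg))

corollary3p23 :
    ∀ {m k : ℕ} (d e : ℕ) → d < e →
    (f : Fin k → ZVec m) → (∀ j → VDeg (f j) d) →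
    LinIndep (λ j → pilot (f j) d) →
    (B′ : ZVec m → Set) →
    (∀ j (b : ZVec m) → B′ b → AsymOrth (f j) b) →
    (h : ZVec m) → VDeg h e →
    (∀ (b : ZVec m) → B′ b → AsymOrth h b) →
    (α : Fin k → RatFun) → IsProjCoeffs f h α →
    (p : Fin m → ℚ) → EQPDegPilot (hPrime f h α) e p →
    ∀ (b : ZVec m) → B′ b → ∀ D′ → VDeg b D′ →
    sumℚ (λ c → p c ℚ.* toℚ (pilot b D′ c)) ≡ 0ℚ
corollary3p23 {m} {k} d e _ f f-deg indep B′ f⊥B′ h h-deg h⊥B′ α _ p h′-eqp b b∈B′ D′ b-deg =
  leadingCoefficient-orthogonal {d = d} {e = e} S-unbounded {u = proj₁ dual} (proj₂ dual)
    (λ j → asymOrth⇒⊥ {u = f j} {b} (f-deg j) b-deg (f⊥B′ j b b∈B′)) (asymOrth⇒⊥ {u = h} {b} h-deg b-deg (h⊥B′ b b∈B′))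
    F H ν (λ j → vDeg⇒leadingTerms {v = f j} (f-deg j)) (vDeg⇒leadingTerms {v = h} h-deg) h′≈
  where
  F : Fin k → Fin m → ℕ → ℚ
  F j c t = toℚ (eval (f j c) t)
  H : Fin m → ℕ → ℚ
  H c t = toℚ (eval (h c) t)
  ν : Fin k → ℕ → ℚ
  ν j t = toℚ (nearest (evalRat (α j) t))
  dual : ∃ (DualFamily (λ j c → toℚ (pilot (f j) d c)))
  dual = linIndep⇒dualFamily (λ j → pilot (f j) d) indep
  h′-leading : ∃ λ S → Unbounded S × LeadingTerms S e (λ c t → toℚ (hPrime f h α t c)) p
  h′-leading = eqpDegPilot⇒leadingTerms {g = hPrime f h α} h′-eqp
  S : ℕ → Set
  S = proj₁ h′-leading
  S-unbounded : Unbounded S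
  S-unbounded = proj₁ (proj₂ h′-leading)
  h′≈ : LeadingTerms S e (λ c t → H c t - sumℚ (λ j → ν j t * F j c t)) p
  h′≈ = leadingTerms-cong {D = e} (λ c t → toℚ-hPrime f h α t c) (proj₂ (proj₂ h′-leading))
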